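{- Consider the broom algorithm's Step 1 run on an instance in which no cycle of length at least $2$ of the initial permutation consists only of star tokens lying on star leaves. Then the number $W$ of swaps performed in Step 1 satisfies $$W=\sum_{p\ \text{path token}} \min\{d(p),r(p)\} + S_U - L.$$
   Context: A broom consists of star leaves $v_1,\dots,v_k$, each adjacent to the center vertex $v_{k+1}$, and a path $v_{k+1},v_{k+2},\dots,v_n$; "right" means toward higher indices. Tokens $1,\dots,n$ are placed one per vertex; token $i$ must reach $v_i$ (then it is home). Tokens $1,\dots,k$ are star tokens, $k+1,\dots,n$ path tokens. The initial permutation has the successor of token $t$ equal to the token initially on $t$'s destination. A centered star chain of token $t_{m+1}$ is a sequence $t_1,\dots,t_{m+1}$ with $t_1$ on the center vertex, $t_2,\dots,t_{m+1}$ on star leaves, and for $1\le i\le m$ the destination of $t_i$ currently containing $t_{i+1}$. Step 1 of the algorithm: while some path token is not home, let $p_{\max}$ be the largest path token not home; if $p_{\max}$ is on a star leaf and has a centered star chain $t_1,\dots,t_m,p_{\max}$, perform the $m$ swaps moving $t_1,\dots,t_m$ home in order (this case is counted as a lucky event); then move $p_{\max}$ home along the tree path. $L$ is the number of times the lucky case occurs. For a path token $p$, $d(p)$ is the distance from any star leaf to $p$'s destination, and $r(p)$ is the number of tokens smaller than $p$ lying to the right of $p$ in the initial placement. $S_U$ is the number of star tokens that are not home in the initial placement. -}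

module Defs where

open import Data.Nat as ℕ using (ℕ; zero; suc; _+_; _∸_; _⊔_; _⊓_; _<_; _≤_)
open import Data.Nat.Properties using (≤-<-trans)
open import Data.Fin as Fin using (Fin; toℕ; fromℕ<)
open import Data.Fin.Properties using (_≟_; toℕ<n)
import Data.Fin.Properties as FinP
open import Data.Fin.Permutation using (Permutation′; _⟨$⟩ʳ_; _⟨$⟩ˡ_; transpose; _∘ₚ_)
open import Data.List using (List; []; _∷_; allFin; filter; last; length; map; foldl)
open import Data.Nat.ListAction using (sum)
open import Data.Maybe using (Maybe; just; nothing)
import Data.Maybe as Maybe
open import Data.Product using (_×_; _,_; ∃)
open import Relation.Binary.PropositionalEquality using (_≡_; _≢_)
open import Relation.Nullary using (¬_; yes; no; ¬?; _×-dec_)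
open import Function using (_∘_)

-- The broom has n vertices, encoded as Fin n: the element i : Fin n is
-- the paper's vertex v_{i+1}.  Star leaves are the i with toℕ i < k
-- (the paper's v_1 … v_k), the centre is the i with toℕ i ≡ k (v_{k+1}),
-- and the path is v_{k+1}, …, v_n, i.e. the i with k ≤ toℕ i.
-- Tokens are also encoded as Fin n: token i : Fin n is the paper's
-- token i+1, and its destination is the vertex with the same index.
--
-- A placement of the tokens (one per vertex) is a permutation
-- π : Permutation′ n, where  π ⟨$⟩ʳ v  is the token on vertex v and
-- π ⟨$⟩ˡ t  is the vertex holding token t.

Config : ℕ → Set
Config = Permutation′

module Broom (n k : ℕ) (k<n : k < n) where

  Vertex Token : Set
  Vertex = Fin n
  Token  = Fin n

  centre : Vertex
  centre = fromℕ< k<n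

  tokenAt : Config n → Vertex → Token
  tokenAt π v = π ⟨$⟩ʳ v

  posOf : Config n → Token → Vertex
  posOf π t = π ⟨$⟩ˡ t

  Home : Config n → Token → Set
  Home π t = posOf π t ≡ t

  StarToken PathToken : Token → Set
  StarToken t = toℕ t < k
  PathToken t = k ≤ toℕ t

  OnStarLeaf : Config n → Token → Set
  OnStarLeaf π t = toℕ (posOf π t) < k

  swap : Config n → Vertex → Vertex → Config n
  swap π a b = transpose a b ∘ₚ π

  succ : Config n → Token → Token
  succ π t = tokenAt π t

  iter : ℕ → (Token → Token) → Token → Token
  iter zero    f x = x
  iter (suc j) f x = f (iter j f x)

  -- The cycle
  -- through t is {succ^j t | j ∈ ℕ}; it has length ≥ 2 iff succ t ≢ t.
  NoStarLeafCycle : Config n → Set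
  NoStarLeafCycle π =
    ¬ (∃ λ t → succ π t ≢ t ×
         (∀ j → StarToken (iter j (succ π) t) × OnStarLeaf π (iter j (succ π) t)))

  -- largest path token that is not home (allFin n is increasing)
  maxNotHome : Config n → Maybe Token
  maxNotHome π =
    last (filter (λ t → (k ℕ.≤? toℕ t) ×-dec ¬? (posOf π t ≟ t)) (allFin n))

  -- centered star chain t₁ … t_m of token p, starting from the token t
  -- currently considered (t₁ = token on the centre).  The chain is
  -- uniquely determined (t_{i+1} is the token on t_i's destination, which
  -- must be a star leaf, i.e. t_i must be a star token); the search stops
  -- with success once the token on t_i's destination is p.  Returns the
  -- list t₁ … t_m.  Fuel n suffices since m ≤ k < n.
  chain : ℕ → Config n → Token → Token → Maybe (List Token)
  chain zero    π t p = nothing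
  chain (suc f) π t p with toℕ t ℕ.<? k
  ... | no  _ = nothing
  ... | yes _ with tokenAt π t ≟ p
  ...   | yes _ = just (t ∷ [])
  ...   | no  _ = Maybe.map (t ∷_) (chain f π (tokenAt π t) p)

  -- next vertex on the tree path from a towards b (a ≢ b)
  next : Vertex → Vertex → Vertex
  next a b with toℕ a ℕ.<? k
  ... | yes _ = centre
  ... | no  _ with a FinP.<? b
  ...   | yes a<b = fromℕ< (≤-<-trans a<b (toℕ<n b))
  ...   | no  _ with toℕ b ℕ.<? k | toℕ a ℕ.≟ k
  ...     | yes _ | yes _ = b
  ...     | _     | _     = Fin.pred a

  -- move token p home along the tree path, one swap per edge;
  -- returns the new configuration and the number of swaps
  -- (fuel n suffices: the broom has diameter < n)
  moveHome : ℕ → Config n → Token → Config n × ℕ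
  moveHome zero    π p = π , 0
  moveHome (suc f) π p with posOf π p ≟ p
  ... | yes _ = π , 0
  ... | no  _ with moveHome f (swap π (posOf π p) (next (posOf π p) p)) p
  ...   | π′ , w = π′ , suc w

  -- perform the swaps moving t₁, …, t_m home in order: t_i is on the
  -- centre and is swapped with the token on its destination
  chainSwaps : Config n → List Token → Config n
  chainSwaps π ts = foldl (λ σ t → swap σ centre t) π ts

  -- one iteration of Step 1 for p = p_max:
  -- result (configuration, swaps performed, 1 if lucky else 0)
  iteration : Config n → Token → Config n × ℕ × ℕ
  iteration π p with toℕ (posOf π p) ℕ.<? k
  ... | no _ with moveHome n π p
  ...   | π′ , w = π′ , w , 0
  iteration π p | yes _ with chain n π (tokenAt π centre) p
  ...   | nothing with moveHome n π p
  ...     | π′ , w = π′ , w , 0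
  iteration π p | yes _ | just ts with moveHome n (chainSwaps π ts) p
  ...     | π′ , w = π′ , length ts + w , 1

  -- Each iteration homes p_max and leaves larger path tokens home, so at
  -- most n iterations happen; fuel n therefore runs Step 1 to completion.
  -- Result: (total swaps W, number of lucky events L)
  run : ℕ → Config n → ℕ × ℕ
  run zero    π = 0 , 0
  run (suc f) π with maxNotHome π
  ... | nothing = 0 , 0
  ... | just p with iteration π p
  ...   | π′ , w , l with run f π′
  ...     | W , L = w + W , l + L

  W : Config n → ℕ
  W π = Data.Product.proj₁ (run n π)

  L : Config n → ℕ
  L π = Data.Product.proj₂ (run n π)

  -- distance from any star leaf to p's destination (paper: p − k, 1-based)
  d : Token → ℕ
  d p = suc (toℕ p ∸ k)

  r : Config n → Token → ℕ
  r π p = length (filter (λ q → (q FinP.<? p) ×-dec (posOf π p FinP.<? posOf π q)) (allFin n))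

  pathTokens : List Token
  pathTokens = filter (λ t → k ℕ.≤? toℕ t) (allFin n)

  sumMin : Config n → ℕ
  sumMin π = sum (map (λ p → d p ⊓ r π p) pathTokens)

  S_U : Config n → ℕ
  S_U π = length (filter (λ t → (toℕ t ℕ.<? k) ×-dec ¬? (posOf π t ≟ t)) (allFin n))

module Submission where

-- Put  Φ σ = Σ_{p path token} min (d p) (r σ p) + S_U σ  for a
-- configuration σ.  Step 1 processes the largest path token p that is not
-- home while every larger token is home; in that situation r σ p is governed
-- by the position of p alone (r σ p + pos p = p whenever p is at or left of
-- its destination on the path).  We show that every swap performed by Step 1
-- lowers Φ by exactly one, except the last swap of a lucky centered star
-- chain, which lowers it by two (once for the swap, once for the lucky
-- event).  Moreover the hypothesis "no cycle of star tokens on star leaves"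
-- is preserved by every swap, and at the end of Step 1 it forces Φ = 0.
-- Summing over the run gives  W + L = Φ(initial) = Σ min (d p) (r p) + S_U.

open import Defs
open import Data.Nat as ℕ using (ℕ; zero; suc; _+_; _∸_; _⊓_; _<_; _≤_; z≤n; s≤s)
import Data.Nat.Properties as NP
open import Data.Nat.Tactic.RingSolver using (solve-∀)
open import Data.Fin as Fin using (Fin; toℕ)
import Data.Fin.Properties as FinP
open import Data.Fin.Permutation using (inverseˡ; inverseʳ)
import Data.Fin.Permutation.Components as PC
open import Data.List using (List; []; _∷_; filter; length; map; tabulate; last)
open import Data.Nat.ListAction using (sum)
open import Data.Maybe using (Maybe; just; nothing)
import Data.Maybe as Maybe
open import Data.Product using (_×_; _,_; proj₁; proj₂; Σ; map₁; map₂)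
open import Data.Sum using (_⊎_; inj₁; inj₂; [_,_]′)
open import Relation.Binary.PropositionalEquality
open import Relation.Nullary using (Dec; yes; no; ¬_; ¬?; _×-dec_)
open import Relation.Nullary.Decidable using (dec-true; dec-false; ¬¬-excluded-middle)
open import Relation.Unary using (Pred; Decidable)
open import Relation.Binary.Definitions using (tri<; tri≈; tri>)
open import Data.Empty using (⊥; ⊥-elim)
open import Function using (_∘_; id)
open import Algebra.Properties.CommutativeMonoid.Sum NP.+-0-commutativeMonoid
  using (sum-cong-≗; ∑-distrib-+; sum-permute; sum-replicate-zero) renaming (sum to ∑)

𝟙 : ∀ {p} {P : Set p} → Dec P → ℕ
𝟙 (yes _) = 1
𝟙 (no _)  = 0

guard : ∀ {p} {P : Set p} → Dec P → ℕ → ℕ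
guard (yes _) x = x
guard (no _)  _ = 0

𝟙-yes : ∀ {p} {P : Set p} (a : Dec P) → P → 𝟙 a ≡ 1
𝟙-yes (yes _) _  = refl
𝟙-yes (no ¬p) x  = ⊥-elim (¬p x)

𝟙-no : ∀ {p} {P : Set p} (a : Dec P) → ¬ P → 𝟙 a ≡ 0
𝟙-no (yes x) ¬p = ⊥-elim (¬p x)
𝟙-no (no _)  _  = refl

𝟙-cong : ∀ {p q} {P : Set p} {Q : Set q} (a : Dec P) (b : Dec Q) → (P → Q) → (Q → P) → 𝟙 a ≡ 𝟙 b
𝟙-cong (yes _) (yes _) _ _ = refl
𝟙-cong (yes x) (no y)  f _ = ⊥-elim (y (f x))
𝟙-cong (no x)  (yes y) _ g = ⊥-elim (x (g y))
𝟙-cong (no _)  (no _)  _ _ = refl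

𝟙-mono : ∀ {p q} {P : Set p} {Q : Set q} (a : Dec P) (b : Dec Q) → (P → Q) → 𝟙 a ≤ 𝟙 b
𝟙-mono (yes x) (yes _) _ = s≤s z≤n
𝟙-mono (yes x) (no y)  f = ⊥-elim (y (f x))
𝟙-mono (no _)  _       _ = z≤n

guard-yes : ∀ {p} {P : Set p} (a : Dec P) {x} → P → guard a x ≡ x
guard-yes (yes _) _  = refl
guard-yes (no ¬p) x  = ⊥-elim (¬p x)

guard-no : ∀ {p} {P : Set p} (a : Dec P) {x} → ¬ P → guard a x ≡ 0
guard-no (yes x) ¬p = ⊥-elim (¬p x)
guard-no (no _)  _  = refl

length-filter-tabulate : ∀ {a p} {A : Set a} {P : Pred A p} (P? : Decidable P) {m} (g : Fin m → A) →
  length (filter P? (tabulate g)) ≡ ∑ (λ i → 𝟙 (P? (g i)))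
length-filter-tabulate P? {zero}  g = refl
length-filter-tabulate P? {suc m} g with P? (g Fin.zero)
... | yes _ = cong suc (length-filter-tabulate P? (g ∘ Fin.suc))
... | no _  = length-filter-tabulate P? (g ∘ Fin.suc)

sum-filter-tabulate : ∀ {a p} {A : Set a} {P : Pred A p} (P? : Decidable P) (f : A → ℕ) {m} (g : Fin m → A) →
  sum (map f (filter P? (tabulate g))) ≡ ∑ (λ i → guard (P? (g i)) (f (g i)))
sum-filter-tabulate P? f {zero}  g = refl
sum-filter-tabulate P? f {suc m} g with P? (g Fin.zero)
... | yes _ = cong (f (g Fin.zero) +_) (sum-filter-tabulate P? f (g ∘ Fin.suc))
... | no _  = sum-filter-tabulate P? f (g ∘ Fin.suc)

∑-mono : ∀ {m} {f g : Fin m → ℕ} → (∀ i → f i ≤ g i) → ∑ f ≤ ∑ g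
∑-mono {zero}  _ = z≤n
∑-mono {suc m} e = NP.+-mono-≤ (e Fin.zero) (∑-mono (e ∘ Fin.suc))

∑-zero : ∀ {m} (f : Fin m → ℕ) → (∀ i → f i ≡ 0) → ∑ f ≡ 0
∑-zero {m} f e = trans (sum-cong-≗ e) (sum-replicate-zero m)

∑-ones : ∀ {m} → ∑ {m} (λ _ → 1) ≡ m
∑-ones {zero}  = refl
∑-ones {suc m} = cong suc (∑-ones {m})

∑-pick : ∀ {m} {f g : Fin m → ℕ} (w : Fin m) (c : ℕ) →
  (∀ v → v ≢ w → f v ≡ g v) → f w ≡ c + g w → ∑ f ≡ c + ∑ g
∑-pick {suc m} {f} {g} Fin.zero c e ew
  rewrite ew | sum-cong-≗ {x = f ∘ Fin.suc} {g ∘ Fin.suc} (λ i → e (Fin.suc i) (λ ())) =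
  NP.+-assoc c (g Fin.zero) _
∑-pick {suc m} {f} {g} (Fin.suc w) c e ew
  rewrite e Fin.zero (λ ())
        | ∑-pick {f = f ∘ Fin.suc} {g ∘ Fin.suc} w c (λ v ne → e (Fin.suc v) (ne ∘ FinP.suc-injective)) ew =
  swap-front (g Fin.zero) c (∑ (g ∘ Fin.suc))
  where
  swap-front : ∀ a b s → a + (b + s) ≡ b + (a + s)
  swap-front = solve-∀

∑-point : ∀ {m} (w : Fin m) → ∑ (λ v → 𝟙 (v FinP.≟ w)) ≡ 1
∑-point {m} w = begin
  ∑ (λ v → 𝟙 (v FinP.≟ w))  ≡⟨ ∑-pick w 1 (λ v v≢w → 𝟙-no (v FinP.≟ w) v≢w) (𝟙-yes (w FinP.≟ w) refl) ⟩
  1 + ∑ {m} (λ _ → 0)       ≡⟨ cong suc (sum-replicate-zero m) ⟩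
  1                         ∎
  where open ≡-Reasoning

count-below : ∀ m c → c ≤ m → ∑ {m} (λ v → 𝟙 (toℕ v ℕ.<? c)) ≡ c
count-below m       zero    _         = ∑-zero {m} _ (λ v → 𝟙-no (toℕ v ℕ.<? 0) (λ ()))
count-below (suc m) (suc c) (s≤s c≤m) =
  cong suc (trans (sum-cong-≗ {m} shift) (count-below m c c≤m))
  where
  shift : ∀ v → 𝟙 (suc (toℕ v) ℕ.<? suc c) ≡ 𝟙 (toℕ v ℕ.<? c)
  shift v = 𝟙-cong (suc (toℕ v) ℕ.<? suc c) (toℕ v ℕ.<? c) NP.≤-pred s≤s

count-above : ∀ m c → c < m → ∑ {m} (λ v → 𝟙 (c ℕ.<? toℕ v)) + suc c ≡ m
count-above m c c<m = begin
  ∑ above + suc c                     ≡⟨ cong (∑ above +_) (count-below m (suc c) c<m) ⟨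
  ∑ above + ∑ below                   ≡⟨ ∑-distrib-+ above below ⟨
  ∑ (λ v → above v + below v)         ≡⟨ sum-cong-≗ {m} (λ v → split (toℕ v)) ⟩
  ∑ {m} (λ _ → 1)                     ≡⟨ ∑-ones ⟩
  m                                   ∎
  where
  open ≡-Reasoning
  above below : Fin m → ℕ
  above v = 𝟙 (c ℕ.<? toℕ v)
  below v = 𝟙 (toℕ v ℕ.<? suc c)
  split : ∀ x → 𝟙 (c ℕ.<? x) + 𝟙 (x ℕ.<? suc c) ≡ 1
  split x with c ℕ.<? x | x ℕ.<? suc c
  ... | yes c<x | yes x≤c = ⊥-elim (NP.<⇒≱ c<x (NP.≤-pred x≤c))
  ... | yes _   | no _    = refl
  ... | no _    | yes _   = refl
  ... | no c≮x  | no x≰c  = ⊥-elim (x≰c (s≤s (NP.≮⇒≥ c≮x)))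

count-between : ∀ m ℓ q → ℓ ≤ q → q < m →
  ∑ {m} (λ v → 𝟙 ((ℓ ℕ.<? toℕ v) ×-dec (toℕ v ℕ.<? suc q))) + suc ℓ ≡ suc q
count-between m ℓ q ℓ≤q q<m = begin
  ∑ between + suc ℓ                ≡⟨ cong (∑ between +_) (count-below m (suc ℓ) (NP.≤-trans (s≤s ℓ≤q) q<m)) ⟨
  ∑ between + ∑ uptoℓ              ≡⟨ ∑-distrib-+ between uptoℓ ⟨
  ∑ (λ v → between v + uptoℓ v)    ≡⟨ sum-cong-≗ {m} (λ v → split (toℕ v)) ⟩
  ∑ {m} (λ v → 𝟙 (toℕ v ℕ.<? suc q)) ≡⟨ count-below m (suc q) q<m ⟩
  suc q                            ∎
  where
  open ≡-Reasoning
  between uptoℓ : Fin m → ℕ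
  between v = 𝟙 ((ℓ ℕ.<? toℕ v) ×-dec (toℕ v ℕ.<? suc q))
  uptoℓ v   = 𝟙 (toℕ v ℕ.<? suc ℓ)
  split : ∀ x → 𝟙 ((ℓ ℕ.<? x) ×-dec (x ℕ.<? suc q)) + 𝟙 (x ℕ.<? suc ℓ) ≡ 𝟙 (x ℕ.<? suc q)
  split x with ℓ ℕ.<? x | x ℕ.<? suc q | x ℕ.<? suc ℓ
  ... | yes ℓ<x | _       | yes x≤ℓ = ⊥-elim (NP.<⇒≱ ℓ<x (NP.≤-pred x≤ℓ))
  ... | yes _   | yes _   | no _    = refl
  ... | yes _   | no _    | no _    = refl
  ... | no _    | yes _   | yes _   = refl
  ... | no _    | no x≰q  | yes x≤ℓ = ⊥-elim (x≰q (NP.≤-trans x≤ℓ (s≤s ℓ≤q)))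
  ... | no ℓ≮x  | _       | no x≰ℓ  = ⊥-elim (x≰ℓ (s≤s (NP.≮⇒≥ ℓ≮x)))

transpose-left : ∀ {m} (a b : Fin m) → PC.transpose a b a ≡ b
transpose-left a b rewrite dec-true (a FinP.≟ a) refl = refl

transpose-right : ∀ {m} (a b : Fin m) → PC.transpose a b b ≡ a
transpose-right a b with b FinP.≟ a
... | yes b≡a = b≡a
... | no _ rewrite dec-true (b FinP.≟ b) refl = refl

transpose-other : ∀ {m} (a b v : Fin m) → v ≢ a → v ≢ b → PC.transpose a b v ≡ v
transpose-other a b v v≢a v≢b rewrite dec-false (v FinP.≟ a) v≢a | dec-false (v FinP.≟ b) v≢b = refl

<⇒≢ : ∀ {m} {x y : Fin m} → toℕ x < toℕ y → x ≢ y
<⇒≢ lt x≡y = NP.<-irrefl (cong toℕ x≡y) lt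

-- The arithmetic behind the lower bound on r: if A + e ≤ B + C, where A and C
-- are the complements of ℓ + 1 and q + 1 in the same total, then e + q ≤ B + ℓ.
cancel-complements : ∀ A B C e ℓ q N → A + e ≤ B + C → A + suc ℓ ≡ N → C + suc q ≡ N → e + q ≤ B + ℓ
cancel-complements A B C e ℓ q N le eA eC = NP.+-cancelʳ-≤ (A + suc ℓ) (e + q) (B + ℓ) (begin
  (e + q) + (A + suc ℓ)  ≡⟨ regroup₁ e q A ℓ ⟩
  (A + e) + (suc q + ℓ)  ≤⟨ NP.+-monoˡ-≤ (suc q + ℓ) le ⟩
  (B + C) + (suc q + ℓ)  ≡⟨ regroup₂ B C q ℓ ⟩
  (B + ℓ) + (C + suc q)  ≡⟨ cong ((B + ℓ) +_) (trans eC (sym eA)) ⟩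
  (B + ℓ) + (A + suc ℓ)  ∎)
  where
  open NP.≤-Reasoning
  regroup₁ : ∀ e q A ℓ → (e + q) + (A + suc ℓ) ≡ (A + e) + (suc q + ℓ)
  regroup₁ = solve-∀
  regroup₂ : ∀ B C q ℓ → (B + C) + (suc q + ℓ) ≡ (B + ℓ) + (C + suc q)
  regroup₂ = solve-∀

last-∷ : ∀ {A : Set} (x : A) xs → last (x ∷ xs) ≡ (last xs Maybe.<∣> just x)
last-∷ x []       = refl
last-∷ x (y ∷ ys) rewrite last-∷ y ys with last ys
... | nothing = refl
... | just _  = refl

module LargestSatisfying {N} {P : Fin N → Set} (P? : ∀ t → Dec (P t)) where
  Largest : ∀ {m} → (Fin m → Fin N) → Maybe (Fin N) → Set
  Largest g nothing  = ∀ i → ¬ P (g i)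
  Largest g (just p) = P p × (Σ _ λ i → g i ≡ p) × (∀ i → P (g i) → toℕ (g i) ≤ toℕ p)

  last-filter : ∀ {m} (g : Fin m → Fin N) → (∀ i j → toℕ i < toℕ j → toℕ (g i) < toℕ (g j)) →
                Largest g (last (filter P? (tabulate g)))
  last-filter {zero}  g increasing = λ ()
  last-filter {suc m} g increasing
    with P? (g Fin.zero) | last-filter (g ∘ Fin.suc) (λ i j i<j → increasing (Fin.suc i) (Fin.suc j) (s≤s i<j))
  ... | no ¬P₀ | later = extend (last (filter P? (tabulate (g ∘ Fin.suc)))) later
    where
    extend : ∀ r → Largest (g ∘ Fin.suc) r → Largest g r
    extend nothing  none Fin.zero    = ¬P₀
    extend nothing  none (Fin.suc i) = none i
    extend (just p) (Pp , (i₀ , at-i₀) , largest) =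
      Pp , (Fin.suc i₀ , at-i₀) , λ { Fin.zero P₀ → ⊥-elim (¬P₀ P₀) ; (Fin.suc i) Pi → largest i Pi }
  ... | yes P₀ | later rewrite last-∷ (g Fin.zero) (filter P? (tabulate (g ∘ Fin.suc))) =
    extend (last (filter P? (tabulate (g ∘ Fin.suc)))) later
    where
    extend : ∀ r → Largest (g ∘ Fin.suc) r → Largest g (r Maybe.<∣> just (g Fin.zero))
    extend nothing  none = P₀ , (Fin.zero , refl) , λ { Fin.zero _ → NP.≤-refl ; (Fin.suc i) Pi → ⊥-elim (none i Pi) }
    extend (just p) (Pp , (i₀ , at-i₀) , largest) = Pp , (Fin.suc i₀ , at-i₀) , λ
      { Fin.zero _ → NP.<⇒≤ (subst (λ w → toℕ (g Fin.zero) < toℕ w) at-i₀ (increasing Fin.zero (Fin.suc i₀) (s≤s z≤n)))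
      ; (Fin.suc i) Pi → largest i Pi }

module Step1 (n k : ℕ) (k<n : k < n) where
  open Broom n k k<n

  posOf-tokenAt : ∀ σ v → posOf σ (tokenAt σ v) ≡ v
  posOf-tokenAt σ v = inverseˡ σ

  tokenAt-posOf : ∀ σ t → tokenAt σ (posOf σ t) ≡ t
  tokenAt-posOf σ t = inverseʳ σ

  tokenAt-injective : ∀ σ {u v} → tokenAt σ u ≡ tokenAt σ v → u ≡ v
  tokenAt-injective σ {u} {v} e = trans (sym (posOf-tokenAt σ u)) (trans (cong (posOf σ) e) (posOf-tokenAt σ v))

  posOf-injective : ∀ σ {u v} → posOf σ u ≡ posOf σ v → u ≡ v
  posOf-injective σ {u} {v} e = trans (sym (tokenAt-posOf σ u)) (trans (cong (tokenAt σ) e) (tokenAt-posOf σ v))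

  tokenAt⇒posOf : ∀ σ {v t} → tokenAt σ v ≡ t → posOf σ t ≡ v
  tokenAt⇒posOf σ {v} e = trans (cong (posOf σ) (sym e)) (posOf-tokenAt σ v)

  posOf⇒tokenAt : ∀ σ {v t} → posOf σ t ≡ v → tokenAt σ v ≡ t
  posOf⇒tokenAt σ {v} {t} e = trans (cong (tokenAt σ) (sym e)) (tokenAt-posOf σ t)

  toℕ-centre : toℕ centre ≡ k
  toℕ-centre = FinP.toℕ-fromℕ< k<n

  leaf≢centre : ∀ (v : Vertex) → toℕ v < k → v ≢ centre
  leaf≢centre v v<k e = NP.<-irrefl (trans (cong toℕ e) toℕ-centre) v<k

  record Swapped (σ σ' : Config n) (a b : Vertex) : Set where
    field
      at-a      : tokenAt σ' a ≡ tokenAt σ b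
      at-b      : tokenAt σ' b ≡ tokenAt σ a
      elsewhere : ∀ v → v ≢ a → v ≢ b → tokenAt σ' v ≡ tokenAt σ v
  open Swapped public

  swapped : ∀ σ a b → Swapped σ (swap σ a b) a b
  swapped σ a b = record
    { at-a      = cong (tokenAt σ) (transpose-left a b)
    ; at-b      = cong (tokenAt σ) (transpose-right a b)
    ; elsewhere = λ v v≢a v≢b → cong (tokenAt σ) (transpose-other a b v v≢a v≢b)
    }

  swapped-flip : ∀ {σ σ' a b} → Swapped σ σ' a b → Swapped σ σ' b a
  swapped-flip h = record { at-a = at-b h ; at-b = at-a h ; elsewhere = λ v p q → elsewhere h v q p }

  swapped-back : ∀ {σ σ' a b} → Swapped σ σ' a b → Swapped σ' σ a b
  swapped-back h = record { at-a = sym (at-b h) ; at-b = sym (at-a h) ; elsewhere = λ v p q → sym (elsewhere h v p q) }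

  module _ {σ σ' : Config n} {a b : Vertex} (h : Swapped σ σ' a b) where
    moves-a : ∀ t → posOf σ t ≡ a → posOf σ' t ≡ b
    moves-a t e = tokenAt⇒posOf σ' (trans (at-b h) (posOf⇒tokenAt σ e))

    moves-b : ∀ t → posOf σ t ≡ b → posOf σ' t ≡ a
    moves-b t e = tokenAt⇒posOf σ' (trans (at-a h) (posOf⇒tokenAt σ e))

    stays : ∀ t → posOf σ t ≢ a → posOf σ t ≢ b → posOf σ' t ≡ posOf σ t
    stays t t≢a t≢b = tokenAt⇒posOf σ' (trans (elsewhere h _ t≢a t≢b) (tokenAt-posOf σ t))

    same-side : toℕ a < toℕ b → ∀ c → (c < toℕ a ⊎ toℕ b < c) →
                ∀ t → c < toℕ (posOf σ t) → c < toℕ (posOf σ' t)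
    same-side a<b c out t c<t with posOf σ t FinP.≟ a | posOf σ t FinP.≟ b | out
    ... | yes e | _     | inj₁ c<a = subst (λ w → c < toℕ w) (sym (moves-a t e)) (NP.<-trans c<a a<b)
    ... | yes e | _     | inj₂ b<c = ⊥-elim (NP.<-asym c<t (subst (λ w → toℕ w < c) (sym e) (NP.<-trans a<b b<c)))
    ... | no _  | yes e | inj₁ c<a = subst (λ w → c < toℕ w) (sym (moves-b t e)) c<a
    ... | no _  | yes e | inj₂ b<c = ⊥-elim (NP.<-asym c<t (subst (λ w → toℕ w < c) (sym e) b<c))
    ... | no t≢a | no t≢b | _      = subst (λ w → c < toℕ w) (sym (stays t t≢a t≢b)) c<t

  -- r σ q counts the tokens below q lying right of q, first read as a sum
  -- over tokens and then, through the bijection tokenAt σ, over vertices.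
  inversion : Config n → Token → Token → ℕ
  inversion σ q y = 𝟙 ((y FinP.<? q) ×-dec (posOf σ q FinP.<? posOf σ y))

  r-by-tokens : ∀ σ q → r σ q ≡ ∑ (inversion σ q)
  r-by-tokens σ q = length-filter-tabulate (λ y → (y FinP.<? q) ×-dec (posOf σ q FinP.<? posOf σ y)) {n} id

  inversionAt : Config n → Token → Vertex → ℕ
  inversionAt σ q v = 𝟙 ((tokenAt σ v FinP.<? q) ×-dec (posOf σ q FinP.<? v))

  r-by-vertices : ∀ σ q → r σ q ≡ ∑ (inversionAt σ q)
  r-by-vertices σ q = trans (r-by-tokens σ q) (trans (sum-permute (inversion σ q) σ) (sum-cong-≗ {n} same))
    where
    same : ∀ v → inversion σ q (tokenAt σ v) ≡ inversionAt σ q v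
    same v = 𝟙-cong _ _ (λ (y<q , lt) → y<q , subst (λ w → toℕ (posOf σ q) < toℕ w) (posOf-tokenAt σ v) lt)
                        (λ (y<q , lt) → y<q , subst (λ w → toℕ (posOf σ q) < toℕ w) (sym (posOf-tokenAt σ v)) lt)

  largerAt : Config n → Token → Vertex → ℕ
  largerAt σ q v = 𝟙 (toℕ q ℕ.<? toℕ (tokenAt σ v))

  larger-tokens : ∀ σ q → ∑ (largerAt σ q) + suc (toℕ q) ≡ n
  larger-tokens σ q =
    trans (cong (_+ suc (toℕ q)) (sym (sum-permute (λ y → 𝟙 (toℕ q ℕ.<? toℕ y)) σ)))
          (count-above n (toℕ q) (FinP.toℕ<n q))

  -- Each vertex right of q holds a smaller token (an inversion) or a larger
  -- one; any extra weight E fitting into this pointwise bound yields a lower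
  -- bound on r σ q.
  r-lower-bound-with : ∀ σ q (E : Vertex → ℕ) →
    (∀ v → 𝟙 (toℕ (posOf σ q) ℕ.<? toℕ v) + E v ≤ inversionAt σ q v + largerAt σ q v) →
    ∑ E + toℕ q ≤ r σ q + toℕ (posOf σ q)
  r-lower-bound-with σ q E bound =
    subst (λ x → ∑ E + toℕ q ≤ x + ℓ) (sym (r-by-vertices σ q))
      (cancel-complements (∑ right) (∑ (inversionAt σ q)) (∑ (largerAt σ q)) (∑ E) ℓ (toℕ q) n summed
        (count-above n ℓ (FinP.toℕ<n (posOf σ q))) (larger-tokens σ q))
    where
    ℓ = toℕ (posOf σ q)
    right : Vertex → ℕ
    right v = 𝟙 (ℓ ℕ.<? toℕ v)
    summed : ∑ right + ∑ E ≤ ∑ (inversionAt σ q) + ∑ (largerAt σ q)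
    summed = subst₂ _≤_ (∑-distrib-+ right E) (∑-distrib-+ (inversionAt σ q) (largerAt σ q)) (∑-mono {n} bound)

  smaller-or-larger : ∀ σ q v → toℕ (posOf σ q) < toℕ v → 1 ≤ inversionAt σ q v + largerAt σ q v
  smaller-or-larger σ q v q<v with NP.<-cmp (toℕ (tokenAt σ v)) (toℕ q)
  ... | tri< t<q _ _ = NP.≤-trans (NP.≤-reflexive (sym (𝟙-yes ((tokenAt σ v FinP.<? q) ×-dec (posOf σ q FinP.<? v)) (t<q , q<v))))
                                  (NP.m≤m+n (inversionAt σ q v) (largerAt σ q v))
  ... | tri≈ _ t≡q _ = ⊥-elim (<⇒≢ q<v (tokenAt⇒posOf σ (FinP.toℕ-injective t≡q)))
  ... | tri> _ _ q<t = NP.≤-trans (NP.≤-reflexive (sym (𝟙-yes (toℕ q ℕ.<? toℕ (tokenAt σ v)) q<t)))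
                                  (NP.m≤n+m (largerAt σ q v) (inversionAt σ q v))

  right-vertex : ∀ σ q v → 𝟙 (toℕ (posOf σ q) ℕ.<? toℕ v) ≤ inversionAt σ q v + largerAt σ q v
  right-vertex σ q v = bound (toℕ (posOf σ q) ℕ.<? toℕ v)
    where
    bound : (q<v? : Dec (toℕ (posOf σ q) < toℕ v)) → 𝟙 q<v? ≤ inversionAt σ q v + largerAt σ q v
    bound (yes q<v) = smaller-or-larger σ q v q<v
    bound (no _)    = z≤n

  -- Lower bound: the q tokens below q cannot all fit left of position(q).
  r-lower : ∀ σ q → toℕ q ≤ r σ q + toℕ (posOf σ q)
  r-lower σ q = subst (λ x → x + toℕ q ≤ r σ q + toℕ (posOf σ q)) (∑-zero {n} (λ _ → 0) (λ _ → refl))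
    (r-lower-bound-with σ q (λ _ → 0) (λ v → NP.≤-trans (NP.≤-reflexive (NP.+-identityʳ _)) (right-vertex σ q v)))

  r-lower-strict : ∀ σ q s → toℕ q < toℕ s → toℕ (posOf σ s) < toℕ (posOf σ q) →
    suc (toℕ q) ≤ r σ q + toℕ (posOf σ q)
  r-lower-strict σ q s q<s s<q = subst (λ x → x + toℕ q ≤ r σ q + toℕ (posOf σ q)) (∑-point (posOf σ s))
    (r-lower-bound-with σ q (λ v → 𝟙 (v FinP.≟ posOf σ s)) bound)
    where
    bound : ∀ v → 𝟙 (toℕ (posOf σ q) ℕ.<? toℕ v) + 𝟙 (v FinP.≟ posOf σ s) ≤ inversionAt σ q v + largerAt σ q v
    bound v with v FinP.≟ posOf σ s
    ... | no _ = NP.≤-trans (NP.≤-reflexive (NP.+-identityʳ _)) (right-vertex σ q v)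
    ... | yes refl
      rewrite 𝟙-no (toℕ (posOf σ q) ℕ.<? toℕ (posOf σ s)) (NP.<⇒≯ s<q)
            | 𝟙-yes (toℕ q ℕ.<? toℕ (tokenAt σ (posOf σ s))) (subst (λ w → toℕ q < toℕ w) (sym (tokenAt-posOf σ s)) q<s)
      = NP.m≤n+m 1 _

  AboveHome : Config n → Token → Set
  AboveHome σ q = ∀ y → toℕ q < toℕ y → Home σ y

  -- Upper bound: if all larger tokens are home and q is at or left of its
  -- destination, every inversion of q lies in (position(q), q].
  r-upper : ∀ σ q → AboveHome σ q → toℕ (posOf σ q) ≤ toℕ q → r σ q + toℕ (posOf σ q) ≤ toℕ q
  r-upper σ q above ℓ≤q = NP.≤-pred (begin
    suc (r σ q + ℓ)                ≡⟨ NP.+-suc (r σ q) ℓ ⟨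
    r σ q + suc ℓ                  ≤⟨ NP.+-monoˡ-≤ (suc ℓ) (subst (_≤ ∑ between) (sym (r-by-vertices σ q)) (∑-mono {n} inside)) ⟩
    ∑ between + suc ℓ              ≡⟨ count-between n ℓ (toℕ q) ℓ≤q (FinP.toℕ<n q) ⟩
    suc (toℕ q)                    ∎)
    where
    open NP.≤-Reasoning
    ℓ = toℕ (posOf σ q)
    between : Vertex → ℕ
    between v = 𝟙 ((ℓ ℕ.<? toℕ v) ×-dec (toℕ v ℕ.<? suc (toℕ q)))
    inside : ∀ v → inversionAt σ q v ≤ between v
    inside v = 𝟙-mono _ _ λ (t<q , ℓ<v) → ℓ<v , s≤s (NP.≮⇒≥ λ q<v →
      NP.<-asym t<q (subst (λ w → toℕ q < toℕ w) (sym (posOf⇒tokenAt σ (above v q<v))) q<v))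

  r-exact : ∀ σ q → AboveHome σ q → toℕ (posOf σ q) ≤ toℕ q → r σ q + toℕ (posOf σ q) ≡ toℕ q
  r-exact σ q above le = NP.≤-antisym (r-upper σ q above le) (r-lower σ q)

  d≤r : ∀ {q r′} → suc q ≤ r′ + k → k ≤ q → suc (q ∸ k) ≤ r′
  d≤r {q} {r′} le k≤q = NP.+-cancelʳ-≤ k (suc (q ∸ k)) r′ (subst (_≤ r′ + k) (sym (cong suc (NP.m∸n+n≡m k≤q))) le)

  min-on-leaf : ∀ σ q → k ≤ toℕ q → toℕ (posOf σ q) < k → d q ⊓ r σ q ≡ d q
  min-on-leaf σ q k≤q leaf = NP.m≤n⇒m⊓n≡m (d≤r (NP.≤-trans (s≤s (r-lower σ q)) shift) k≤q)
    where
    shift : suc (r σ q + toℕ (posOf σ q)) ≤ r σ q + k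
    shift = subst (_≤ r σ q + k) (NP.+-suc (r σ q) _) (NP.+-monoʳ-≤ (r σ q) leaf)

  min-at-centre : ∀ σ q s → k ≤ toℕ q → toℕ (posOf σ q) ≡ k → toℕ q < toℕ s → toℕ (posOf σ s) < k →
                  d q ⊓ r σ q ≡ d q
  min-at-centre σ q s k≤q at-centre q<s s-leaf = NP.m≤n⇒m⊓n≡m (d≤r strict k≤q)
    where
    strict : suc (toℕ q) ≤ r σ q + k
    strict = subst (λ c → suc (toℕ q) ≤ r σ q + c) at-centre
               (r-lower-strict σ q s q<s (subst (toℕ (posOf σ s) <_) (sym at-centre) s-leaf))

  min-on-path : ∀ σ q → AboveHome σ q → k ≤ toℕ (posOf σ q) → toℕ (posOf σ q) ≤ toℕ q → d q ⊓ r σ q ≡ r σ q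
  min-on-path σ q above on-path left = NP.m≥n⇒m⊓n≡n (NP.m≤n⇒m≤1+n (NP.m+n≤o⇒m≤o∸n (r σ q) bound))
    where
    bound : r σ q + k ≤ toℕ q
    bound = subst (r σ q + k ≤_) (r-exact σ q above left) (NP.+-monoʳ-≤ (r σ q) on-path)

  module _ {σ σ' : Config n} {a b : Vertex} (h : Swapped σ σ' a b) (a<b : toℕ a < toℕ b) where
    r-unchanged : ∀ z → (toℕ (posOf σ z) < toℕ a ⊎ toℕ b < toℕ (posOf σ z)) → r σ' z ≡ r σ z
    r-unchanged z out = begin
      r σ' z                ≡⟨ r-by-tokens σ' z ⟩
      ∑ (inversion σ' z)    ≡⟨ sum-cong-≗ {n} same ⟩
      ∑ (inversion σ z)     ≡⟨ r-by-tokens σ z ⟨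
      r σ z                 ∎
      where
      open ≡-Reasoning
      z≢a : posOf σ z ≢ a
      z≢a e = [ NP.<-irrefl (cong toℕ e) , NP.<-asym a<b ∘ subst (λ w → toℕ b < toℕ w) e ]′ out
      z≢b : posOf σ z ≢ b
      z≢b e = [ NP.<-asym a<b ∘ subst (λ w → toℕ w < toℕ a) e , NP.<-irrefl (cong toℕ (sym e)) ]′ out
      z-stays : posOf σ' z ≡ posOf σ z
      z-stays = stays h z z≢a z≢b
      c = toℕ (posOf σ z)
      same : ∀ y → inversion σ' z y ≡ inversion σ z y
      same y = 𝟙-cong _ _
        (λ (y<z , lt) → y<z , same-side (swapped-back h) a<b c out y (subst (λ w → toℕ w < _) z-stays lt))
        (λ (y<z , lt) → y<z , subst (λ w → toℕ w < _) (sym z-stays) (same-side h a<b c out y lt))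

  above-home-kept : ∀ {σ σ' a b} → Swapped σ σ' a b → ∀ p → toℕ a ≤ toℕ p → toℕ b ≤ toℕ p →
                    AboveHome σ p → AboveHome σ' p
  above-home-kept h p a≤p b≤p above y p<y =
    trans (stays h y (λ e → <⇒≢ (NP.≤-<-trans a≤p p<y) (trans (sym e) (above y p<y)))
                     (λ e → <⇒≢ (NP.≤-<-trans b≤p p<y) (trans (sym e) (above y p<y))))
          (above y p<y)

  Φ : Config n → ℕ
  Φ σ = sumMin σ + S_U σ

  minTerm : Config n → Token → ℕ
  minTerm σ t = guard (k ℕ.≤? toℕ t) (d t ⊓ r σ t)

  strayStar : Config n → Token → ℕ
  strayStar σ t = 𝟙 ((toℕ t ℕ.<? k) ×-dec ¬? (posOf σ t FinP.≟ t))

  Φ-as-sums : ∀ σ → Φ σ ≡ ∑ (minTerm σ) + ∑ (strayStar σ)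
  Φ-as-sums σ = cong₂ _+_ (sum-filter-tabulate (λ t → k ℕ.≤? toℕ t) (λ p → d p ⊓ r σ p) {n} id)
                          (length-filter-tabulate (λ t → (toℕ t ℕ.<? k) ×-dec ¬? (posOf σ t FinP.≟ t)) {n} id)

  Φ-drop : ∀ σ σ' c₁ c₂ → ∑ (minTerm σ) ≡ c₁ + ∑ (minTerm σ') → ∑ (strayStar σ) ≡ c₂ + ∑ (strayStar σ') →
           Φ σ ≡ (c₁ + c₂) + Φ σ'
  Φ-drop σ σ' c₁ c₂ e₁ e₂ rewrite Φ-as-sums σ | Φ-as-sums σ' | e₁ | e₂ =
    interchange c₁ c₂ (∑ (minTerm σ')) (∑ (strayStar σ'))
    where
    interchange : ∀ a b c d → a + c + (b + d) ≡ a + b + (c + d)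
    interchange = solve-∀

  minTerm-path : ∀ σ z → k ≤ toℕ z → minTerm σ z ≡ d z ⊓ r σ z
  minTerm-path σ z k≤z = guard-yes (k ℕ.≤? toℕ z) k≤z

  minTerm-star : ∀ σ z → toℕ z < k → minTerm σ z ≡ 0
  minTerm-star σ z z<k = guard-no (k ℕ.≤? toℕ z) (NP.<⇒≱ z<k)

  minTerm-cong : ∀ σ σ' z → (k ≤ toℕ z → d z ⊓ r σ z ≡ d z ⊓ r σ' z) → minTerm σ z ≡ minTerm σ' z
  minTerm-cong σ σ' z same with k ℕ.≤? toℕ z
  ... | yes k≤z = same k≤z
  ... | no _    = refl

  strayStar-cong : ∀ σ σ' t → (toℕ t < k → (¬ Home σ t → ¬ Home σ' t) × (¬ Home σ' t → ¬ Home σ t)) →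
                   strayStar σ t ≡ strayStar σ' t
  strayStar-cong σ σ' t same = 𝟙-cong _ _ (λ (s , ¬h) → s , proj₁ (same s) ¬h) (λ (s , ¬h) → s , proj₂ (same s) ¬h)

  star-home-kept : ∀ {σ σ' a b} → Swapped σ σ' a b → k ≤ toℕ a → k ≤ toℕ b →
                   ∀ t → toℕ t < k → Home σ t → Home σ' t
  star-home-kept h k≤a k≤b t t<k home =
    trans (stays h t (λ e → <⇒≢ (NP.<-≤-trans t<k k≤a) (trans (sym home) e))
                     (λ e → <⇒≢ (NP.<-≤-trans t<k k≤b) (trans (sym home) e)))
          home

  strayStar-path-swap : ∀ {σ σ' a b} → Swapped σ σ' a b → k ≤ toℕ a → k ≤ toℕ b →
                        ∀ t → strayStar σ t ≡ strayStar σ' t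
  strayStar-path-swap {σ} {σ'} h k≤a k≤b t = strayStar-cong σ σ' t λ t<k →
    (λ ¬home home' → ¬home (star-home-kept (swapped-back h) k≤a k≤b t t<k home')) ,
    (λ ¬home' home → ¬home' (star-home-kept h k≤a k≤b t t<k home))

  outside-adjacent : ∀ {a b v : Vertex} → toℕ b ≡ suc (toℕ a) → v ≢ a → v ≢ b → toℕ v < toℕ a ⊎ toℕ b < toℕ v
  outside-adjacent {a} {b} {v} adjacent v≢a v≢b with NP.<-cmp (toℕ v) (toℕ a)
  ... | tri< v<a _ _ = inj₁ v<a
  ... | tri≈ _ v≡a _ = ⊥-elim (v≢a (FinP.toℕ-injective v≡a))
  ... | tri> _ _ a<v = inj₂ (NP.≤∧≢⇒< (subst (_≤ toℕ v) (sym adjacent) a<v) (λ e → v≢b (FinP.toℕ-injective (sym e))))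

  -- Moving p one step right along the path, towards its destination, lowers
  -- Φ by one: r p drops by one, the token x passed over keeps its r (the only
  -- token changing sides with x is p > x), and no star token changes status.
  module RightStep {σ σ' : Config n} {a b : Vertex} (h : Swapped σ σ' a b) (p : Token)
                   (p-at-a : posOf σ p ≡ a) (k≤a : k ≤ toℕ a) (adjacent : toℕ b ≡ suc (toℕ a))
                   (b≤p : toℕ b ≤ toℕ p) (above : AboveHome σ p) where
    a<b : toℕ a < toℕ b
    a<b = subst (toℕ a <_) (sym adjacent) NP.≤-refl

    k≤b : k ≤ toℕ b
    k≤b = NP.≤-trans k≤a (NP.<⇒≤ a<b)

    p-at-b : posOf σ' p ≡ b
    p-at-b = moves-a h p p-at-a

    above′ : AboveHome σ' p
    above′ = above-home-kept h p (NP.<⇒≤ (NP.<-≤-trans a<b b≤p)) b≤p above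

    x : Token
    x = tokenAt σ b

    x-at-b : posOf σ x ≡ b
    x-at-b = posOf-tokenAt σ b

    x<p : toℕ x < toℕ p
    x<p with NP.<-cmp (toℕ x) (toℕ p)
    ... | tri< x<p _ _ = x<p
    ... | tri≈ _ x≡p _ = ⊥-elim (<⇒≢ a<b (trans (sym p-at-a) (trans (cong (posOf σ) (sym (FinP.toℕ-injective x≡p))) x-at-b)))
    ... | tri> _ _ p<x = ⊥-elim (NP.<⇒≱ p<x (subst (_≤ toℕ p) (cong toℕ (trans (sym x-at-b) (above x p<x))) b≤p))

    below-x-elsewhere : ∀ y → toℕ y < toℕ x → posOf σ y ≢ a × posOf σ y ≢ b
    below-x-elsewhere y y<x =
      (λ e → NP.<-asym y<x (subst (λ w → toℕ x < toℕ w) (sym (posOf-injective σ (trans e (sym p-at-a)))) x<p)) ,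
      (λ e → NP.<-irrefl (cong toℕ (posOf-injective σ (trans e (sym x-at-b)))) y<x)

    r-x-kept : r σ x ≡ r σ' x
    r-x-kept = trans (r-by-tokens σ x) (trans (sum-cong-≗ {n} same) (sym (r-by-tokens σ' x)))
      where
      x-at-a : posOf σ' x ≡ a
      x-at-a = moves-b h x x-at-b
      same : ∀ y → inversion σ x y ≡ inversion σ' x y
      same y = 𝟙-cong _ _
        (λ (y<x , b<y) → y<x , subst₂ (λ u w → toℕ u < toℕ w) (sym x-at-a) (sym (y-stays y<x))
                                  (NP.<-trans a<b (subst (λ w → toℕ w < _) x-at-b b<y)))
        (λ (y<x , a<y) → y<x , subst (λ w → toℕ w < _) (sym x-at-b)
                                  (right-of-b y<x (subst₂ (λ u w → toℕ u < toℕ w) x-at-a (y-stays y<x) a<y)))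
        where
        y-stays : toℕ y < toℕ x → posOf σ' y ≡ posOf σ y
        y-stays y<x = stays h y (proj₁ (below-x-elsewhere y y<x)) (proj₂ (below-x-elsewhere y y<x))
        right-of-b : toℕ y < toℕ x → toℕ a < toℕ (posOf σ y) → toℕ b < toℕ (posOf σ y)
        right-of-b y<x a<y = NP.≤∧≢⇒< (subst (_≤ _) (sym adjacent) a<y)
                               (λ e → proj₂ (below-x-elsewhere y y<x) (FinP.toℕ-injective (sym e)))

    minTerm-others : ∀ z → z ≢ p → minTerm σ z ≡ minTerm σ' z
    minTerm-others z z≢p = minTerm-cong σ σ' z (λ _ → cong (d z ⊓_) r-kept)
      where
      r-kept : r σ z ≡ r σ' z
      r-kept with z FinP.≟ x
      ... | yes refl = r-x-kept
      ... | no z≢x = sym (r-unchanged h a<b z (outside-adjacent adjacent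
                      (λ e → z≢p (posOf-injective σ (trans e (sym p-at-a))))
                      (λ e → z≢x (posOf-injective σ (trans e (sym x-at-b))))))

    p-on-path  : k ≤ toℕ (posOf σ p)
    p-on-path  = subst (λ w → k ≤ toℕ w) (sym p-at-a) k≤a
    p-on-path′ : k ≤ toℕ (posOf σ' p)
    p-on-path′ = subst (λ w → k ≤ toℕ w) (sym p-at-b) k≤b
    p-left  : toℕ (posOf σ p) ≤ toℕ p
    p-left  = subst (λ w → toℕ w ≤ toℕ p) (sym p-at-a) (NP.<⇒≤ (NP.<-≤-trans a<b b≤p))
    p-left′ : toℕ (posOf σ' p) ≤ toℕ p
    p-left′ = subst (λ w → toℕ w ≤ toℕ p) (sym p-at-b) b≤p

    r-p-drops : r σ p ≡ 1 + r σ' p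
    r-p-drops = NP.+-cancelʳ-≡ (toℕ a) _ _ (begin
      r σ p + toℕ a          ≡⟨ subst (λ w → r σ p + toℕ w ≡ toℕ p) p-at-a (r-exact σ p above p-left) ⟩
      toℕ p                  ≡⟨ subst (λ w → r σ' p + toℕ w ≡ toℕ p) p-at-b (r-exact σ' p above′ p-left′) ⟨
      r σ' p + toℕ b         ≡⟨ cong (r σ' p +_) adjacent ⟩
      r σ' p + suc (toℕ a)   ≡⟨ NP.+-suc (r σ' p) (toℕ a) ⟩
      suc (r σ' p) + toℕ a   ∎)
      where open ≡-Reasoning

    minTerm-p : minTerm σ p ≡ 1 + minTerm σ' p
    minTerm-p = begin
      minTerm σ p          ≡⟨ minTerm-path σ p k≤p ⟩
      d p ⊓ r σ p          ≡⟨ min-on-path σ p above p-on-path p-left ⟩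
      r σ p                ≡⟨ r-p-drops ⟩
      1 + r σ' p           ≡⟨ cong suc (min-on-path σ' p above′ p-on-path′ p-left′) ⟨
      1 + (d p ⊓ r σ' p)   ≡⟨ cong suc (minTerm-path σ' p k≤p) ⟨
      1 + minTerm σ' p     ∎
      where
      open ≡-Reasoning
      k≤p : k ≤ toℕ p
      k≤p = NP.≤-trans k≤b b≤p

    Φ-step : Φ σ ≡ 1 + Φ σ'
    Φ-step = Φ-drop σ σ' 1 0 (∑-pick p 1 minTerm-others minTerm-p) (sum-cong-≗ {n} (strayStar-path-swap h k≤a k≤b))

  -- The remaining tokens keep
  -- their contributions: those on other leaves stay on a leaf, where their
  -- min term is d, and those right of the centre keep their r.
  module LeafCentreSwap {σ σ' : Config n} {ℓ : Vertex} (h : Swapped σ σ' ℓ centre) (ℓ-leaf : toℕ ℓ < k) where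
    ℓ<centre : toℕ ℓ < toℕ centre
    ℓ<centre = subst (toℕ ℓ <_) (sym toℕ-centre) ℓ-leaf

    minTerm-elsewhere : ∀ z → posOf σ z ≢ ℓ → posOf σ z ≢ centre → minTerm σ z ≡ minTerm σ' z
    minTerm-elsewhere z z≢ℓ z≢c with toℕ (posOf σ z) ℕ.<? k
    ... | yes z-leaf = minTerm-cong σ σ' z λ k≤z →
            trans (min-on-leaf σ z k≤z z-leaf) (sym (min-on-leaf σ' z k≤z (subst (λ w → toℕ w < k) (sym z-stays) z-leaf)))
      where z-stays = stays h z z≢ℓ z≢c
    ... | no z-path = minTerm-cong σ σ' z λ _ → cong (d z ⊓_) (sym (r-unchanged h ℓ<centre z (inj₂ centre<z)))
      where
      centre<z : toℕ centre < toℕ (posOf σ z)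
      centre<z = NP.≤∧≢⇒< (subst (_≤ _) (sym toℕ-centre) (NP.≮⇒≥ z-path)) (λ e → z≢c (FinP.toℕ-injective (sym e)))

    strayStar-elsewhere : ∀ z → posOf σ z ≢ ℓ → posOf σ z ≢ centre → strayStar σ z ≡ strayStar σ' z
    strayStar-elsewhere z z≢ℓ z≢c = cong (λ w → 𝟙 ((toℕ z ℕ.<? k) ×-dec ¬? (w FinP.≟ z))) (sym (stays h z z≢ℓ z≢c))

    above-kept : ∀ p → k ≤ toℕ p → AboveHome σ p → AboveHome σ' p
    above-kept p k≤p = above-home-kept h p (NP.≤-trans (NP.<⇒≤ ℓ-leaf) k≤p) (subst (_≤ toℕ p) (sym toℕ-centre) k≤p)

    -- A path token moving from ℓ to the centre: its min term drops from d p
    -- to r = p − k = d p − 1.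
    minTerm-arriving : ∀ p → posOf σ p ≡ ℓ → k ≤ toℕ p → AboveHome σ p → minTerm σ p ≡ 1 + minTerm σ' p
    minTerm-arriving p p-at-ℓ k≤p above = begin
      minTerm σ p           ≡⟨ minTerm-path σ p k≤p ⟩
      d p ⊓ r σ p           ≡⟨ min-on-leaf σ p k≤p (subst (λ w → toℕ w < k) (sym p-at-ℓ) ℓ-leaf) ⟩
      suc (toℕ p ∸ k)       ≡⟨ cong (λ w → suc (w ∸ k)) r-at-centre ⟨
      suc (r σ' p + k ∸ k)  ≡⟨ cong suc (NP.m+n∸n≡m (r σ' p) k) ⟩
      1 + r σ' p            ≡⟨ cong suc (min-on-path σ' p above′ (NP.≤-reflexive (sym p-at-k)) p-left′) ⟨
      1 + (d p ⊓ r σ' p)    ≡⟨ cong suc (minTerm-path σ' p k≤p) ⟨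
      1 + minTerm σ' p      ∎
      where
      open ≡-Reasoning
      above′ = above-kept p k≤p above
      p-at-k : toℕ (posOf σ' p) ≡ k
      p-at-k = trans (cong toℕ (moves-a h p p-at-ℓ)) toℕ-centre
      p-left′ : toℕ (posOf σ' p) ≤ toℕ p
      p-left′ = subst (_≤ toℕ p) (sym p-at-k) k≤p
      r-at-centre : r σ' p + k ≡ toℕ p
      r-at-centre = subst (λ w → r σ' p + w ≡ toℕ p) p-at-k (r-exact σ' p above′ p-left′)

  -- Moving p from a star leaf ℓ to the centre lowers Φ by one, provided the
  -- token t on the centre does not have ℓ as its destination: p loses one,
  -- while t (smaller than p) has min term d both on the centre, next to p
  -- on a leaf, and on ℓ, and a star token t stays away from home.
  leaf-to-centre-step : ∀ {σ σ' ℓ} → Swapped σ σ' ℓ centre → toℕ ℓ < k → ∀ p → posOf σ p ≡ ℓ → k ≤ toℕ p →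
                        AboveHome σ p → tokenAt σ centre ≢ ℓ → Φ σ ≡ 1 + Φ σ'
  leaf-to-centre-step {σ} {σ'} {ℓ} h ℓ-leaf p p-at-ℓ k≤p above t≢ℓ =
    Φ-drop σ σ' 1 0 (∑-pick p 1 minTerm-others (minTerm-arriving p p-at-ℓ k≤p above)) (sum-cong-≗ {n} strays)
    where
    open LeafCentreSwap h ℓ-leaf
    t = tokenAt σ centre
    t-at-centre : posOf σ t ≡ centre
    t-at-centre = posOf-tokenAt σ centre
    t-at-k : toℕ (posOf σ t) ≡ k
    t-at-k = trans (cong toℕ t-at-centre) toℕ-centre
    p-leaf : toℕ (posOf σ p) < k
    p-leaf = subst (λ w → toℕ w < k) (sym p-at-ℓ) ℓ-leaf
    t<p : toℕ t < toℕ p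
    t<p with NP.<-cmp (toℕ t) (toℕ p)
    ... | tri< t<p _ _ = t<p
    ... | tri≈ _ t≡p _ = ⊥-elim (NP.<-irrefl (trans (cong (toℕ ∘ posOf σ) (FinP.toℕ-injective (sym t≡p))) t-at-k) p-leaf)
    ... | tri> _ _ p<t = ⊥-elim (NP.<⇒≱ p<t (subst (_≤ toℕ p) (trans (sym t-at-k) (cong toℕ (above t p<t))) k≤p))
    t-to-ℓ : posOf σ' t ≡ ℓ
    t-to-ℓ = moves-b h t t-at-centre
    position-elsewhere : ∀ z → z ≢ p → z ≢ t → posOf σ z ≢ ℓ × posOf σ z ≢ centre
    position-elsewhere z z≢p z≢t = (λ e → z≢p (posOf-injective σ (trans e (sym p-at-ℓ)))) ,
                                   (λ e → z≢t (posOf-injective σ (trans e (sym t-at-centre))))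
    minTerm-others : ∀ z → z ≢ p → minTerm σ z ≡ minTerm σ' z
    minTerm-others z z≢p with z FinP.≟ t
    ... | yes refl = minTerm-cong σ σ' z λ k≤z →
            trans (min-at-centre σ z p k≤z t-at-k t<p p-leaf)
                  (sym (min-on-leaf σ' z k≤z (subst (λ w → toℕ w < k) (sym t-to-ℓ) ℓ-leaf)))
    ... | no z≢t = minTerm-elsewhere z (proj₁ (position-elsewhere z z≢p z≢t)) (proj₂ (position-elsewhere z z≢p z≢t))
    strays : ∀ z → strayStar σ z ≡ strayStar σ' z
    strays z with z FinP.≟ t | z FinP.≟ p
    ... | yes refl | _ = strayStar-cong σ σ' z λ z<k →
            (λ _ home → t≢ℓ (trans (sym home) t-to-ℓ)) ,
            (λ _ home → NP.<-irrefl (trans (cong toℕ (sym home)) t-at-k) z<k)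
    ... | no _ | yes refl = strayStar-cong σ σ' z λ z<k → ⊥-elim (NP.<⇒≱ z<k k≤p)
    ... | no z≢t | no z≢p = strayStar-elsewhere z (proj₁ (position-elsewhere z z≢p z≢t)) (proj₂ (position-elsewhere z z≢p z≢t))

  -- One swap of a centered star chain: the star token x on the centre goes
  -- home to its leaf and the token y there moves to the centre.  S_U drops
  -- by one (x becomes home, y stays away from home).  If y is a star token
  -- nothing else changes; if y is the path token p ending the chain, its min
  -- term drops by one as well.
  module ChainSwap {σ σ' : Config n} {x : Vertex} (h : Swapped σ σ' x centre) (x-star : toℕ x < k)
                   (x-at-centre : posOf σ x ≡ centre) where
    open LeafCentreSwap h x-star

    y : Token
    y = tokenAt σ x

    y-at-x : posOf σ y ≡ x
    y-at-x = posOf-tokenAt σ x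

    y≢x : y ≢ x
    y≢x e = leaf≢centre x x-star (trans (sym (trans (cong (posOf σ) (sym e)) y-at-x)) x-at-centre)

    elsewhere-than : ∀ z → z ≢ x → z ≢ y → posOf σ z ≢ x × posOf σ z ≢ centre
    elsewhere-than z z≢x z≢y = (λ e → z≢y (posOf-injective σ (trans e (sym y-at-x)))) ,
                               (λ e → z≢x (posOf-injective σ (trans e (sym x-at-centre))))

    strays-drop : ∑ (strayStar σ) ≡ 1 + ∑ (strayStar σ')
    strays-drop = ∑-pick x 1 others x-goes-home
      where
      x-at-k : toℕ (posOf σ x) ≡ k
      x-at-k = trans (cong toℕ x-at-centre) toℕ-centre
      x-goes-home : strayStar σ x ≡ 1 + strayStar σ' x
      x-goes-home = trans (𝟙-yes _ (x-star , λ home → NP.<-irrefl (trans (cong toℕ (sym home)) x-at-k) x-star))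
                          (cong suc (sym (𝟙-no _ (λ (_ , ¬home) → ¬home (moves-b h x x-at-centre)))))
      others : ∀ z → z ≢ x → strayStar σ z ≡ strayStar σ' z
      others z z≢x with z FinP.≟ y
      ... | yes refl = strayStar-cong σ σ' z λ z<k →
              (λ _ home → NP.<-irrefl (trans (cong toℕ (sym home)) (trans (cong toℕ (moves-a h z y-at-x)) toℕ-centre)) z<k) ,
              (λ _ home → y≢x (trans (sym home) y-at-x))
      ... | no z≢y = strayStar-elsewhere z (proj₁ (elsewhere-than z z≢x z≢y)) (proj₂ (elsewhere-than z z≢x z≢y))

    chain-step : toℕ y < k → Φ σ ≡ 1 + Φ σ'
    chain-step y-star = Φ-drop σ σ' 0 1 (sum-cong-≗ {n} minTerms) strays-drop
      where
      minTerms : ∀ z → minTerm σ z ≡ minTerm σ' z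
      minTerms z with z FinP.≟ x | z FinP.≟ y
      ... | yes refl | _        = trans (minTerm-star σ z x-star) (sym (minTerm-star σ' z x-star))
      ... | no _     | yes refl = trans (minTerm-star σ z y-star) (sym (minTerm-star σ' z y-star))
      ... | no z≢x   | no z≢y   = minTerm-elsewhere z (proj₁ (elsewhere-than z z≢x z≢y)) (proj₂ (elsewhere-than z z≢x z≢y))

    chain-last : ∀ p → y ≡ p → k ≤ toℕ p → AboveHome σ p → Φ σ ≡ 2 + Φ σ'
    chain-last p refl k≤p above = Φ-drop σ σ' 1 1 (∑-pick p 1 minTerms (minTerm-arriving p y-at-x k≤p above)) strays-drop
      where
      minTerms : ∀ z → z ≢ p → minTerm σ z ≡ minTerm σ' z
      minTerms z z≢y with z FinP.≟ x
      ... | yes refl = trans (minTerm-star σ z x-star) (sym (minTerm-star σ' z x-star))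
      ... | no z≢x   = minTerm-elsewhere z (proj₁ (elsewhere-than z z≢x z≢y)) (proj₂ (elsewhere-than z z≢x z≢y))

  iter-+ : ∀ m j (f : Token → Token) x → iter (m + j) f x ≡ iter m f (iter j f x)
  iter-+ zero    j f x = refl
  iter-+ (suc m) j f x = cong f (iter-+ m j f x)

  iter-injective : ∀ (f : Token → Token) → (∀ {u v} → f u ≡ f v → u ≡ v) → ∀ j {u v} → iter j f u ≡ iter j f v → u ≡ v
  iter-injective f f-inj zero    e = e
  iter-injective f f-inj (suc j) e = iter-injective f f-inj j (f-inj e)

  iter-agree : ∀ (f g : Token → Token) x → (∀ j → f (iter j f x) ≡ g (iter j f x)) → ∀ j → iter j f x ≡ iter j g x
  iter-agree f g x agree zero    = refl
  iter-agree f g x agree (suc j) = trans (agree j) (cong g (iter-agree f g x agree j))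

  iter-fixed : ∀ (f : Token → Token) → (∀ {u v} → f u ≡ f v → u ≡ v) →
               ∀ x → f x ≡ x → ∀ j t → iter j f t ≡ x → t ≡ x
  iter-fixed f f-inj x fx zero    t e = e
  iter-fixed f f-inj x fx (suc j) t e = iter-fixed f f-inj x fx j t (f-inj (trans e (sym fx)))

  period : ∀ σ x → Σ ℕ λ c → 1 ≤ c × c ≤ n × iter c (succ σ) x ≡ x
  period σ x with FinP.pigeonhole (NP.n<1+n n) (λ (i : Fin (suc n)) → iter (toℕ i) (succ σ) x)
  ... | i , j , i<j , e =
    c , NP.m<n⇒0<n∸m i<j , NP.≤-trans (NP.m∸n≤m (toℕ j) (toℕ i)) (NP.≤-pred (FinP.toℕ<n j)) ,
    iter-injective (succ σ) (tokenAt-injective σ) (toℕ i)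
      (trans (sym (iter-+ (toℕ i) c (succ σ) x)) (trans (cong (λ w → iter w (succ σ) x) (NP.m+[n∸m]≡n (NP.<⇒≤ i<j))) (sym e)))
    where c = toℕ j ∸ toℕ i

  OnLeafAsStar : Config n → Token → Set
  OnLeafAsStar σ y = StarToken y × OnStarLeaf σ y

  StarLeafCycle : Config n → Token → Set
  StarLeafCycle σ t = succ σ t ≢ t × (∀ j → OnLeafAsStar σ (iter j (succ σ) t))

  cycle-transfer : ∀ {σ σ' a b} → Swapped σ σ' a b → NoStarLeafCycle σ → ∀ t₀ → StarLeafCycle σ' t₀ →
    (∀ j → iter j (succ σ') t₀ ≢ a × iter j (succ σ') t₀ ≢ b) →
    (∀ j → posOf σ' (iter j (succ σ') t₀) ≢ a × posOf σ' (iter j (succ σ') t₀) ≢ b) → ⊥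
  cycle-transfer {σ} {σ'} h no-cycle t₀ (nontrivial , on-leaves) avoid-dest avoid-pos =
    no-cycle (t₀ , nontrivial′ , on-leaves′)
    where
    succ-agrees : ∀ j → succ σ' (iter j (succ σ') t₀) ≡ succ σ (iter j (succ σ') t₀)
    succ-agrees j = elsewhere h _ (proj₁ (avoid-dest j)) (proj₂ (avoid-dest j))
    same-orbit : ∀ j → iter j (succ σ') t₀ ≡ iter j (succ σ) t₀
    same-orbit = iter-agree (succ σ') (succ σ) t₀ succ-agrees
    nontrivial′ : succ σ t₀ ≢ t₀
    nontrivial′ e = nontrivial (trans (succ-agrees 0) e)
    on-leaves′ : ∀ j → OnLeafAsStar σ (iter j (succ σ) t₀)
    on-leaves′ j = subst (OnLeafAsStar σ) (same-orbit j)
      (proj₁ (on-leaves j) ,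
       subst (λ w → toℕ w < k) (sym (stays (swapped-back h) _ (proj₁ (avoid-pos j)) (proj₂ (avoid-pos j)))) (proj₂ (on-leaves j)))

  no-cycle-path-swap : ∀ {σ σ' a b} → Swapped σ σ' a b → k ≤ toℕ a → k ≤ toℕ b → NoStarLeafCycle σ → NoStarLeafCycle σ'
  no-cycle-path-swap h k≤a k≤b no-cycle (t₀ , cyc) = cycle-transfer h no-cycle t₀ cyc
    (λ j → not-path (proj₁ (on-leaves j)) k≤a , not-path (proj₁ (on-leaves j)) k≤b)
    (λ j → not-path (proj₂ (on-leaves j)) k≤a , not-path (proj₂ (on-leaves j)) k≤b)
    where
    on-leaves = proj₂ cyc
    not-path : ∀ {v w : Vertex} → toℕ v < k → k ≤ toℕ w → v ≢ w
    not-path v<k k≤w e = NP.<⇒≱ v<k (subst (λ u → k ≤ toℕ u) (sym e) k≤w)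

  -- Sending a star token x home from the centre cannot create a star-leaf
  -- cycle: afterwards x is a fixed point, so no nontrivial cycle meets x,
  -- and the centre is not a star leaf.
  no-cycle-chain-swap : ∀ {σ σ' x} → Swapped σ σ' x centre → toℕ x < k → posOf σ x ≡ centre →
                        NoStarLeafCycle σ → NoStarLeafCycle σ'
  no-cycle-chain-swap {σ} {σ'} {x} h x-star x-at-centre no-cycle (t₀ , nontrivial , on-leaves) =
    cycle-transfer h no-cycle t₀ (nontrivial , on-leaves)
      (λ j → avoids-x j , leaf≢centre _ (proj₁ (on-leaves j)))
      (λ j → (λ e → avoids-x j (trans (sym (tokenAt-posOf σ' _)) (trans (cong (tokenAt σ') e) x-fixed))) ,
             leaf≢centre _ (proj₂ (on-leaves j)))
    where
    x-fixed : succ σ' x ≡ x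
    x-fixed = trans (at-a h) (posOf⇒tokenAt σ x-at-centre)
    avoids-x : ∀ j → iter j (succ σ') t₀ ≢ x
    avoids-x j e = nontrivial (trans (cong (succ σ') t₀≡x) (trans x-fixed (sym t₀≡x)))
      where t₀≡x = iter-fixed (succ σ') (tokenAt-injective σ') x x-fixed j t₀ e

  chain-continues : ∀ σ f y p → toℕ y < k → (tokenAt σ y ≢ p → chain f σ (tokenAt σ y) p ≢ nothing) →
                    chain (suc f) σ y p ≢ nothing
  chain-continues σ f y p y-star rest with toℕ y ℕ.<? k
  ... | no y-not-star = ⊥-elim (y-not-star y-star)
  ... | yes _ with tokenAt σ y FinP.≟ p
  ...   | yes _  = λ ()
  ...   | no y↛p = λ e → rest y↛p (map-nothing (chain f σ (tokenAt σ y) p) e)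
    where
    map-nothing : ∀ {A B : Set} {g : A → B} (m : Maybe A) → Maybe.map g m ≡ nothing → m ≡ nothing
    map-nothing nothing  _ = refl
    map-nothing (just _) ()

  n-positive : Σ ℕ λ n′ → n ≡ suc n′
  n-positive = positive k<n
    where
    positive : ∀ {m} → k < m → Σ ℕ λ m′ → m ≡ suc m′
    positive {suc m} _ = m , refl

  -- A new cycle must pass through ℓ:
  -- otherwise it avoids the swapped vertices (it also avoids the former centre
  -- token t, whose σ'-predecessor is ℓ).  But a star-leaf cycle through ℓ
  -- would, starting from t, be a centered star chain of p in σ.
  no-cycle-leaf-to-centre : ∀ {σ σ' ℓ p} → Swapped σ σ' ℓ centre → toℕ ℓ < k → posOf σ p ≡ ℓ →
    chain n σ (tokenAt σ centre) p ≡ nothing → NoStarLeafCycle σ → NoStarLeafCycle σ'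
  no-cycle-leaf-to-centre {σ} {σ'} {ℓ} {p} h ℓ-leaf p-at-ℓ no-chain no-cycle (t₀ , nontrivial , on-leaves) =
    ¬¬-excluded-middle cases
    where
    f′ = succ σ'
    t = tokenAt σ centre
    ℓ↦t : f′ ℓ ≡ t
    ℓ↦t = at-a h
    cases : Dec (Σ ℕ λ j → iter j f′ t₀ ≡ ℓ) → ⊥
    cases (no avoids-ℓ) = cycle-transfer h no-cycle t₀ (nontrivial , on-leaves)
        (λ j → (λ e → avoids-ℓ (j , e)) , leaf≢centre _ (proj₁ (on-leaves j)))
        (λ j → (λ e → avoids-t j (trans (sym (tokenAt-posOf σ' _)) (trans (cong (tokenAt σ') e) ℓ↦t))) ,
               leaf≢centre _ (proj₂ (on-leaves j)))
      where
      avoids-t : ∀ j → iter j f′ t₀ ≢ t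
      avoids-t j e with period σ' t
      ... | zero    , () , _
      ... | suc c , _ , _ , back = avoids-ℓ (c + j , trans (iter-+ c j f′ t₀) (trans (cong (iter c f′) e) reaches-ℓ))
        where
        reaches-ℓ : iter c f′ t ≡ ℓ
        reaches-ℓ = tokenAt-injective σ' (trans back (sym ℓ↦t))
    cases (yes (j , through-ℓ)) with period σ' ℓ
    ... | c , 1≤c , c≤n , back = follow n 0 1≤c c≤n (trans (cong (λ w → chain n σ w p) ℓ↦t) no-chain)
      where
      on-leaves-ℓ : ∀ i → OnLeafAsStar σ' (iter i f′ ℓ)
      on-leaves-ℓ i = subst (OnLeafAsStar σ') (trans (iter-+ i j f′ t₀) (cong (iter i f′) through-ℓ)) (on-leaves (i + j))
      -- the chain search from the (i+1)-st token after ℓ follows the cycle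
      -- and succeeds when it comes back to ℓ, whose token in σ is p
      follow : ∀ fuel i → suc i ≤ c → c ≤ i + fuel → chain fuel σ (iter (suc i) f′ ℓ) p ≢ nothing
      follow zero       i i<c c≤i = ⊥-elim (NP.<⇒≱ i<c (subst (c ≤_) (NP.+-identityʳ i) c≤i))
      follow (suc fuel) i i<c c≤i = chain-continues σ fuel y p y-star continue
        where
        y = iter (suc i) f′ ℓ
        y-star = proj₁ (on-leaves-ℓ (suc i))
        continue : tokenAt σ y ≢ p → chain fuel σ (tokenAt σ y) p ≢ nothing
        continue y↛p = subst (λ w → chain fuel σ w p ≢ nothing) (elsewhere h y y≢ℓ (leaf≢centre y y-star))
                         (follow fuel (suc i) i+1<c (subst (c ≤_) (NP.+-suc i fuel) c≤i))
          where
          y≢ℓ : y ≢ ℓ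
          y≢ℓ e = y↛p (trans (cong (tokenAt σ) e) (posOf⇒tokenAt σ p-at-ℓ))
          i+1<c : suc (suc i) ≤ c
          i+1<c = NP.≤∧≢⇒< i<c (λ e → y≢ℓ (trans (cong (λ w → iter w f′ ℓ) e) back))

  next-from-leaf : ∀ a b → toℕ a < k → next a b ≡ centre
  next-from-leaf a b a-leaf with toℕ a ℕ.<? k
  ... | yes _      = refl
  ... | no ¬a-leaf = ⊥-elim (¬a-leaf a-leaf)

  next-rightwards : ∀ a b → ¬ (toℕ a < k) → toℕ a < toℕ b → toℕ (next a b) ≡ suc (toℕ a)
  next-rightwards a b ¬a-leaf a<b with toℕ a ℕ.<? k
  ... | yes a-leaf = ⊥-elim (¬a-leaf a-leaf)
  ... | no _ with a FinP.<? b
  ...   | yes _  = FinP.toℕ-fromℕ< _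
  ...   | no a≮b = ⊥-elim (a≮b a<b)

  HomeRun : Config n → Token → Config n × ℕ → Set
  HomeRun σ p (σ' , w) = w + Φ σ' ≡ Φ σ × NoStarLeafCycle σ' × Home σ' p × AboveHome σ' p

  home-run-step : ∀ σ σ₁ p r → Φ σ ≡ 1 + Φ σ₁ → HomeRun σ₁ p r → HomeRun σ p (map₂ suc r)
  home-run-step σ σ₁ p r drop (cost , rest) = trans (cong suc cost) (sym drop) , rest

  moving-right : ∀ f σ p → k ≤ toℕ (posOf σ p) → toℕ (posOf σ p) ≤ toℕ p → toℕ p ∸ toℕ (posOf σ p) ≤ f →
                 AboveHome σ p → NoStarLeafCycle σ → HomeRun σ p (moveHome f σ p)
  moving-right zero σ p on-path left fuel above no-cycle =
    refl , no-cycle , FinP.toℕ-injective (NP.≤-antisym left (NP.m∸n≡0⇒m≤n (NP.n≤0⇒n≡0 fuel))) , above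
  moving-right (suc f) σ p on-path left fuel above no-cycle with posOf σ p FinP.≟ p
  ... | yes home = refl , no-cycle , home , above
  ... | no ¬home =
    home-run-step σ σ₁ p (moveHome f σ₁ p) Φ-step
      (moving-right f σ₁ p on-path′ (subst (λ w → toℕ w ≤ toℕ p) (sym p-at-b) b≤p) fuel′ above′
        (no-cycle-path-swap h on-path k≤b no-cycle))
    where
    a = posOf σ p
    b = next a p
    σ₁ = swap σ a b
    h = swapped σ a b
    a<p : toℕ a < toℕ p
    a<p = NP.≤∧≢⇒< left (¬home ∘ FinP.toℕ-injective)
    adjacent : toℕ b ≡ suc (toℕ a)
    adjacent = next-rightwards a p (NP.≤⇒≯ on-path) a<p
    b≤p : toℕ b ≤ toℕ p
    b≤p = subst (_≤ toℕ p) (sym adjacent) a<p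
    open RightStep h p refl on-path adjacent b≤p above
    on-path′ : k ≤ toℕ (posOf σ₁ p)
    on-path′ = subst (λ w → k ≤ toℕ w) (sym p-at-b) k≤b
    fuel′ : toℕ p ∸ toℕ (posOf σ₁ p) ≤ f
    fuel′ = subst (λ w → toℕ p ∸ toℕ w ≤ f) (sym p-at-b) (subst (λ w → toℕ p ∸ w ≤ f) (sym adjacent)
              (NP.≤-pred (subst (_≤ suc f) (NP.+-∸-assoc 1 a<p) fuel)))

  at-or-left : ∀ σ p → AboveHome σ p → toℕ (posOf σ p) ≤ toℕ p
  at-or-left σ p above = NP.≮⇒≥ λ p<pos →
    NP.<-irrefl (cong toℕ (trans (sym (tokenAt-posOf σ p)) (posOf⇒tokenAt σ (above _ p<pos)))) p<pos

  moving-from-centre : ∀ f σ p → toℕ (posOf σ p) ≡ k → k ≤ toℕ p → toℕ p < suc f →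
                       AboveHome σ p → NoStarLeafCycle σ → HomeRun σ p (moveHome f σ p)
  moving-from-centre f σ p at-centre k≤p p≤f above =
    moving-right f σ p (NP.≤-reflexive (sym at-centre)) (subst (_≤ toℕ p) (sym at-centre) k≤p)
      (subst (λ w → toℕ p ∸ w ≤ f) (sym at-centre) (NP.≤-trans (NP.m∸n≤m (toℕ p) k) (NP.≤-pred p≤f))) above

  chain-from-own-leaf : ∀ σ p → toℕ (posOf σ p) < k → chain n σ (posOf σ p) p ≢ nothing
  chain-from-own-leaf σ p leaf none with n-positive
  ... | n′ , refl = chain-continues σ n′ (posOf σ p) p leaf (λ ↛p → ⊥-elim (↛p (tokenAt-posOf σ p))) none

  moving-from-leaf : ∀ f σ p → toℕ (posOf σ p) < k → k ≤ toℕ p → toℕ p < suc f → AboveHome σ p →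
                     NoStarLeafCycle σ → chain n σ (tokenAt σ centre) p ≡ nothing → HomeRun σ p (moveHome (suc f) σ p)
  moving-from-leaf f σ p leaf k≤p p≤f above no-cycle no-chain with posOf σ p FinP.≟ p
  ... | yes home = ⊥-elim (NP.<⇒≱ leaf (subst (λ w → k ≤ toℕ w) (sym home) k≤p))
  ... | no _ rewrite next-from-leaf (posOf σ p) p leaf =
    home-run-step σ σ₁ p (moveHome f σ₁ p) (leaf-to-centre-step h leaf p refl k≤p above centre↛ℓ)
      (moving-from-centre f σ₁ p (trans (cong toℕ (moves-a h p refl)) toℕ-centre) k≤p p≤f
        (LeafCentreSwap.above-kept h leaf p k≤p above) (no-cycle-leaf-to-centre h leaf refl no-chain no-cycle))
    where
    ℓ = posOf σ p
    σ₁ = swap σ ℓ centre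
    h = swapped σ ℓ centre
    centre↛ℓ : tokenAt σ centre ≢ ℓ
    centre↛ℓ e = chain-from-own-leaf σ p leaf (trans (cong (λ w → chain n σ w p) (sym e)) no-chain)

  data StarChain (σ : Config n) (p : Token) : Token → List Token → Set where
    last-link : ∀ {x} → toℕ x < k → tokenAt σ x ≡ p → StarChain σ p x (x ∷ [])
    link      : ∀ {x ts} → toℕ x < k → tokenAt σ x ≢ p → StarChain σ p (tokenAt σ x) ts → StarChain σ p x (x ∷ ts)

  chain-sound : ∀ f σ x p ts → chain f σ x p ≡ just ts → StarChain σ p x ts
  chain-sound zero σ x p ts ()
  chain-sound (suc f) σ x p ts found with toℕ x ℕ.<? k
  ... | no _ = case found
    where case : nothing ≡ just ts → StarChain σ p x ts
          case ()
  ... | yes x-star with tokenAt σ x FinP.≟ p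
  ...   | yes x↦p = case found
    where case : just (x ∷ []) ≡ just ts → StarChain σ p x ts
          case refl = last-link x-star x↦p
  ...   | no x↛p with chain f σ (tokenAt σ x) p in rest
  ...     | nothing = case found
    where case : nothing ≡ just ts → StarChain σ p x ts
          case ()
  ...     | just ts′ = case found
    where case : just (x ∷ ts′) ≡ just ts → StarChain σ p x ts
          case refl = link x-star x↛p (chain-sound f σ (tokenAt σ x) p ts′ rest)

  chain-head-star : ∀ {σ p x ts} → StarChain σ p x ts → toℕ x < k
  chain-head-star (last-link x-star _) = x-star
  chain-head-star (link x-star _ _)    = x-star

  chain-kept : ∀ {σ σ₁ p x} → (∀ v → v ≢ x → toℕ v < k → tokenAt σ₁ v ≡ tokenAt σ v) →
               (∀ z → toℕ z < k → tokenAt σ z ≢ x) → ∀ {y ts} → y ≢ x → StarChain σ p y ts → StarChain σ₁ p y ts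
  chain-kept agree x-off-leaves y≢x (last-link y-star y↦p) = last-link y-star (trans (agree _ y≢x y-star) y↦p)
  chain-kept {σ} {σ₁} {p} agree x-off-leaves {y} y≢x (link y-star y↛p rest) =
    link y-star (λ e → y↛p (trans (sym (agree _ y≢x y-star)) e))
      (subst (λ w → StarChain σ₁ p w _) (sym (agree _ y≢x y-star))
        (chain-kept agree x-off-leaves (x-off-leaves y y-star) rest))

  -- Outcome of the swaps along a centered star chain ts of p: Φ drops by
  -- length ts + 1 (the swaps and the lucky event), p ends on the centre,
  -- and both invariants are kept.
  ChainRun : Config n → Token → List Token → Set
  ChainRun σ p ts = Φ σ ≡ suc (length ts) + Φ (chainSwaps σ ts) × posOf (chainSwaps σ ts) p ≡ centre ×
                    AboveHome (chainSwaps σ ts) p × NoStarLeafCycle (chainSwaps σ ts)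

  chain-run : ∀ σ p x ts → StarChain σ p x ts → tokenAt σ centre ≡ x → k ≤ toℕ p → AboveHome σ p →
              NoStarLeafCycle σ → ChainRun σ p ts
  chain-run σ p x (x ∷ []) (last-link x-star x↦p) centre↦x k≤p above no-cycle =
    ChainSwap.chain-last h x-star x-at-centre p x↦p k≤p above ,
    moves-a h p (tokenAt⇒posOf σ x↦p) ,
    LeafCentreSwap.above-kept h x-star p k≤p above ,
    no-cycle-chain-swap h x-star x-at-centre no-cycle
    where
    h = swapped-flip (swapped σ centre x)
    x-at-centre = tokenAt⇒posOf σ centre↦x
  chain-run σ p x (x ∷ ts) (link x-star x↛p rest) centre↦x k≤p above no-cycle =
    map₁ (λ drop → trans (ChainSwap.chain-step h x-star x-at-centre (chain-head-star rest)) (cong suc drop))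
      (chain-run σ₁ p (tokenAt σ x) ts (chain-kept agree x-off-leaves y≢x rest) (at-b h) k≤p
        (LeafCentreSwap.above-kept h x-star p k≤p above) (no-cycle-chain-swap h x-star x-at-centre no-cycle))
    where
    σ₁ = swap σ centre x
    h = swapped-flip (swapped σ centre x)
    x-at-centre = tokenAt⇒posOf σ centre↦x
    agree : ∀ v → v ≢ x → toℕ v < k → tokenAt σ₁ v ≡ tokenAt σ v
    agree v v≢x v-leaf = elsewhere h v v≢x (leaf≢centre v v-leaf)
    x-off-leaves : ∀ z → toℕ z < k → tokenAt σ z ≢ x
    x-off-leaves z z-leaf e = leaf≢centre z z-leaf (trans (sym (tokenAt⇒posOf σ e)) x-at-centre)
    y≢x = ChainSwap.y≢x h x-star x-at-centre

  IterationRun : Config n → Token → Config n × ℕ × ℕ → Set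
  IterationRun σ p (σ' , w , l) = (w + l) + Φ σ' ≡ Φ σ × NoStarLeafCycle σ' × Home σ' p × AboveHome σ' p

  unlucky : ∀ σ p r → HomeRun σ p r → IterationRun σ p (proj₁ r , proj₂ r , 0)
  unlucky σ p (σ' , w) (cost , rest) = trans (cong (_+ Φ σ') (NP.+-identityʳ w)) cost , rest

  iteration-run : ∀ σ p → k ≤ toℕ p → AboveHome σ p → NoStarLeafCycle σ → IterationRun σ p (iteration σ p)
  iteration-run σ p k≤p above no-cycle with toℕ (posOf σ p) ℕ.<? k
  ... | no off-leaf = unlucky σ p (moveHome n σ p)
          (moving-right n σ p (NP.≮⇒≥ off-leaf) (at-or-left σ p above)
            (NP.≤-trans (NP.m∸n≤m (toℕ p) (toℕ (posOf σ p))) (NP.<⇒≤ (FinP.toℕ<n p))) above no-cycle)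
  ... | yes leaf with chain n σ (tokenAt σ centre) p in found
  ...   | nothing with n-positive
  ...     | n′ , refl = unlucky σ p (moveHome n σ p) (moving-from-leaf n′ σ p leaf k≤p (FinP.toℕ<n p) above no-cycle found)
  iteration-run σ p k≤p above no-cycle | yes leaf | just ts =
    lucky (moveHome n σ₁ p)
      (moving-from-centre n σ₁ p (trans (cong toℕ at-centre) toℕ-centre) k≤p (NP.m≤n⇒m≤1+n (FinP.toℕ<n p)) above₁ no-cycle₁)
    where
    σ₁ = chainSwaps σ ts
    chain-outcome = chain-run σ p _ ts (chain-sound n σ _ p ts found) refl k≤p above no-cycle
    at-centre = proj₁ (proj₂ chain-outcome)
    above₁ = proj₁ (proj₂ (proj₂ chain-outcome))
    no-cycle₁ = proj₂ (proj₂ (proj₂ chain-outcome))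
    lucky : ∀ r → HomeRun σ₁ p r → IterationRun σ p (proj₁ r , length ts + proj₂ r , 1)
    lucky (σ' , w) (cost , rest) = (begin
      (length ts + w + 1) + Φ σ'    ≡⟨ regroup (length ts) w (Φ σ') ⟩
      suc (length ts) + (w + Φ σ')  ≡⟨ cong (suc (length ts) +_) cost ⟩
      suc (length ts) + Φ σ₁        ≡⟨ proj₁ chain-outcome ⟨
      Φ σ                           ∎) , rest
      where
      open ≡-Reasoning
      regroup : ∀ a b c → (a + b + 1) + c ≡ suc a + (b + c)
      regroup = solve-∀

  notHomePath? : ∀ σ t → Dec (k ≤ toℕ t × ¬ Home σ t)
  notHomePath? σ t = (k ℕ.≤? toℕ t) ×-dec ¬? (posOf σ t FinP.≟ t)

  maxNotHome-spec : ∀ σ → LargestSatisfying.Largest (notHomePath? σ) id (maxNotHome σ)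
  maxNotHome-spec σ = LargestSatisfying.last-filter (notHomePath? σ) id (λ i j i<j → i<j)

  HomeFrom : Config n → ℕ → Set
  HomeFrom σ b = ∀ t → k ≤ toℕ t → b ≤ toℕ t → Home σ t

  module AllPathHome (σ : Config n) (path-home : ∀ t → k ≤ toℕ t → Home σ t) where
    star-on-leaf : ∀ t → toℕ t < k → toℕ (posOf σ t) < k
    star-on-leaf t t<k = NP.≰⇒> λ k≤pos → NP.<⇒≱ t<k (subst (λ w → k ≤ toℕ w) (same-token k≤pos) k≤pos)
      where
      same-token : k ≤ toℕ (posOf σ t) → posOf σ t ≡ t
      same-token k≤pos = trans (sym (posOf⇒tokenAt σ (path-home _ k≤pos))) (tokenAt-posOf σ t)

    leaf-holds-star : ∀ v → toℕ v < k → toℕ (tokenAt σ v) < k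
    leaf-holds-star v v<k = NP.≰⇒> λ k≤t → NP.<⇒≱ v<k (subst (λ w → k ≤ toℕ w) (same-vertex k≤t) k≤t)
      where
      same-vertex : k ≤ toℕ (tokenAt σ v) → tokenAt σ v ≡ v
      same-vertex k≤t = trans (sym (path-home _ k≤t)) (posOf-tokenAt σ v)

    star-orbit : ∀ t → toℕ t < k → ∀ j → OnLeafAsStar σ (iter j (succ σ) t)
    star-orbit t t<k zero    = t<k , star-on-leaf t t<k
    star-orbit t t<k (suc j) = star , star-on-leaf _ star
      where star = leaf-holds-star _ (proj₁ (star-orbit t t<k j))

    -- so under the cycle hypothesis all star tokens are home, and Φ vanishes
    Φ-vanishes : NoStarLeafCycle σ → Φ σ ≡ 0
    Φ-vanishes no-cycle = trans (Φ-as-sums σ) (cong₂ _+_ (∑-zero {n} (minTerm σ) no-min) (∑-zero {n} (strayStar σ) no-stray))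
      where
      no-min : ∀ z → minTerm σ z ≡ 0
      no-min z with k ℕ.≤? toℕ z
      ... | no _    = refl
      ... | yes k≤z = cong (d z ⊓_) r-zero
        where
        home = path-home z k≤z
        r-zero : r σ z ≡ 0
        r-zero = NP.n≤0⇒n≡0 (NP.+-cancelʳ-≤ (toℕ z) (r σ z) 0
          (subst (λ w → r σ z + toℕ w ≤ toℕ z) home
            (r-upper σ z (λ y z<y → path-home y (NP.≤-trans k≤z (NP.<⇒≤ z<y))) (NP.≤-reflexive (cong toℕ home)))))
      no-stray : ∀ t → strayStar σ t ≡ 0
      no-stray t = 𝟙-no _ λ (t<k , ¬home) → no-cycle (t , (λ e → ¬home (tokenAt⇒posOf σ e)) , star-orbit t t<k)

  run-cost : ∀ f σ b → b ≤ k + f → HomeFrom σ b → NoStarLeafCycle σ → proj₁ (run f σ) + proj₂ (run f σ) ≡ Φ σ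
  run-cost zero σ b b≤k home-from no-cycle =
    sym (AllPathHome.Φ-vanishes σ (λ t k≤t → home-from t k≤t (NP.≤-trans (subst (b ≤_) (NP.+-identityʳ k) b≤k) k≤t)) no-cycle)
  run-cost (suc f) σ b b≤k+f home-from no-cycle with maxNotHome σ | maxNotHome-spec σ
  ... | nothing | none = sym (AllPathHome.Φ-vanishes σ all-home no-cycle)
    where
    all-home : ∀ t → k ≤ toℕ t → Home σ t
    all-home t k≤t with posOf σ t FinP.≟ t
    ... | yes home = home
    ... | no ¬home = ⊥-elim (none t (k≤t , ¬home))
  ... | just p | (k≤p , ¬home) , _ , largest =
    continue (iteration σ p) (iteration-run σ p k≤p above no-cycle)
    where
    above : AboveHome σ p
    above y p<y with posOf σ y FinP.≟ y
    ... | yes home  = home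
    ... | no ¬homey = ⊥-elim (NP.<⇒≱ p<y (largest y (NP.≤-trans k≤p (NP.<⇒≤ p<y) , ¬homey)))
    p<b : toℕ p < b
    p<b = NP.≰⇒> λ b≤p → ¬home (home-from p k≤p b≤p)
    p≤k+f : toℕ p ≤ k + f
    p≤k+f = NP.≤-pred (subst (toℕ p <_) (NP.+-suc k f) (NP.<-≤-trans p<b b≤k+f))
    continue : ∀ it → IterationRun σ p it →
               let (σ' , w , l) = it in (w + proj₁ (run f σ')) + (l + proj₂ (run f σ')) ≡ Φ σ
    continue (σ' , w , l) (cost , no-cycle′ , home′ , above′) = begin
      (w + W′) + (l + L′)  ≡⟨ interchange w W′ l L′ ⟩
      (w + l) + (W′ + L′)  ≡⟨ cong ((w + l) +_) (run-cost f σ' (toℕ p) p≤k+f home-from′ no-cycle′) ⟩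
      (w + l) + Φ σ'       ≡⟨ cost ⟩
      Φ σ                  ∎
      where
      open ≡-Reasoning
      W′ = proj₁ (run f σ')
      L′ = proj₂ (run f σ')
      interchange : ∀ a b c d → (a + b) + (c + d) ≡ (a + c) + (b + d)
      interchange = solve-∀
      home-from′ : HomeFrom σ' (toℕ p)
      home-from′ t k≤t p≤t with toℕ p ℕ.≟ toℕ t
      ... | yes p≡t = subst (Home σ') (FinP.toℕ-injective p≡t) home′
      ... | no p≢t  = above′ t (NP.≤∧≢⇒< p≤t p≢t)

  step1-cost : ∀ σ → NoStarLeafCycle σ → W σ + L σ ≡ sumMin σ + S_U σ
  step1-cost σ no-cycle = run-cost n σ n (NP.m≤n+m n k) (λ t _ n≤t → ⊥-elim (NP.<⇒≱ (FinP.toℕ<n t) n≤t)) no-cycle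

lemma7p2 : (n k : ℕ) → 1 ≤ k → (k<n : k < n) → (π : Config n) →
    Broom.NoStarLeafCycle n k k<n π →
    Broom.W n k k<n π + Broom.L n k k<n π ≡ Broom.sumMin n k k<n π + Broom.S_U n k k<n π
lemma7p2 n k _ k<n π no-cycle = Step1.step1-cost n k k<n π no-cycle
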